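{- For all positive integers $s,H,n$, the game $\langle K_{1,n},h_{s,H},g_s\rangle$ is winning if and only if a perfect hash family $\mathrm{PHF}(n;H,s+1,s+1)$ exists.
   Context: $K_{1,n}$ is the star with center $A$ and $n$ leaves. The functions on its vertices are: - $h_{s,H}(v)=s+1$ for $v\ne A$, and $h_{s,H}(A)=H$; - $g_s(v)=1$ for $v\ne A$, and $g_s(A)=s$. A perfect hash family $\mathrm{PHF}(N;k,v,t)$ is an $N\times k$ array with entries from a set of $v$ symbols such that in every $N\times t$ subarray (choice of $t$ columns) at least one row consists of $t$ distinct symbols. Hat guessing game $\langle G,h,g\rangle$: $G=(V,E)$ is a finite graph and $h,g\colon V\to\mathbb N$. The adversary gives each vertex $v$ a color in $\{0,\dots,h(v)-1\}$. Each vertex sees only its neighbors' colors and names at most $g(v)$ colors via a deterministic strategy fixed in advance that depends only on those colors. The game is winning if some strategy ensures that for every assignment some vertex names its own color. -}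

module Defs where

open import Data.Nat using (ℕ; zero; suc)
open import Data.Fin using (Fin; zero; suc)
open import Data.Vec using (Vec)
open import Data.Vec.Membership.Propositional using (_∈_)
open import Data.Product using (Σ; ∃; _×_; _,_)
open import Data.Empty using (⊥)
open import Data.Unit using (⊤)
open import Relation.Binary.PropositionalEquality using (_≡_)
open import Function.Definitions using (Injective)

record Graph : Set₁ where
  field
    m   : ℕ
    Adj : Fin m → Fin m → Set

open Graph public

Coloring : (G : Graph) → (Fin (m G) → ℕ) → Set
Coloring G h = (v : Fin (m G)) → Fin (h v)

-- A strategy: each vertex names a list of g(v) colors (repetitions allowed,
-- so at most g(v) distinct colors), as a function of the coloring.
Strategy : (G : Graph) → (h g : Fin (m G) → ℕ) → Set
Strategy G h g = (v : Fin (m G)) → Coloring G h → Vec (Fin (h v)) (g v)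

Local : (G : Graph) → (h g : Fin (m G) → ℕ) → Strategy G h g → Set
Local G h g f = (v : Fin (m G)) (c c' : Coloring G h) →
  ((u : Fin (m G)) → Adj G v u → c u ≡ c' u) → f v c ≡ f v c'

Winning : (G : Graph) → (h g : Fin (m G) → ℕ) → Set
Winning G h g = Σ (Strategy G h g) λ f → Local G h g f ×
  ((c : Coloring G h) → ∃ λ v → c v ∈ f v c)

-- The star K_{1,n}: vertex set Fin (1+n), center A = zero, leaves suc i.
starAdj : {n : ℕ} → Fin (suc n) → Fin (suc n) → Set
starAdj zero    zero    = ⊥
starAdj zero    (suc _) = ⊤
starAdj (suc _) zero    = ⊤
starAdj (suc _) (suc _) = ⊥

K1 : ℕ → Graph
K1 n = record { m = suc n ; Adj = starAdj }

hSH : (s H n : ℕ) → Fin (suc n) → ℕ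
hSH s H n zero    = H
hSH s H n (suc _) = suc s

gS : (s n : ℕ) → Fin (suc n) → ℕ
gS s n zero    = s
gS s n (suc _) = 1

IsPHF : (N k v t : ℕ) → (Fin N → Fin k → Fin v) → Set
IsPHF N k v t a = (cols : Fin t → Fin k) → Injective _≡_ _≡_ cols →
  ∃ λ (r : Fin N) → Injective _≡_ _≡_ (λ j → a r (cols j))

PHFExists : (N k v t : ℕ) → Set
PHFExists N k v t = ∃ λ (a : Fin N → Fin k → Fin v) → IsPHF N k v t a

-- Leaf i sees only the centre, so its strategy is a map a_i from centre colours
-- to leaf colours: a row of an n × H array over s+1 symbols.  When the leaves
-- wear x, the centre is the only hope exactly at the columns c avoiding x
-- (a_i(c) ≠ x_i for all i), so a winning strategy exists iff for every x at
-- most s columns avoid x.  That is the PHF property: a row injective on s+1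
-- columns takes every value and so meets x; and if no row is injective on some
-- s+1 columns, every row misses a value, and the missed values form an x
-- avoided by all those columns.
module Submission where

open import Defs
open import Data.Nat using (ℕ; zero; suc; _<_; _≤_; z≤n; s≤s)
open import Data.Nat.Properties using (n<1+n)
open import Data.Fin using (Fin; zero; suc; punchOut; _≟_)
open import Data.Fin.Properties
  using (any?; all?; ¬∀⟶∃¬; <⇒notInjective; punchOut-injective; suc-injective)
open import Data.List using (List; []; _∷_; length; map)
open import Data.List.Properties using (length-map)
open import Data.List.Membership.Propositional using () renaming (_∈_ to _∈ₗ_)
open import Data.List.Membership.Propositional.Properties using (∈-map⁺)
import Data.List.Relation.Unary.Any as ListAny
open import Data.Vec using (Vec; []; _∷_; head; lookup; tabulate; fromList; padRight)
open import Data.Vec.Properties using (tabulate-cong; lookup∘tabulate)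
open import Data.Vec.Membership.Propositional using (_∈_)
open import Data.Vec.Membership.Propositional.Properties using (∈-fromList⁺)
open import Data.Vec.Relation.Unary.Any using (here; there; index)
open import Data.Vec.Relation.Unary.Any.Properties using (lookup-index)
open import Data.Product using (∃; _×_; _,_; proj₁; proj₂)
open import Data.Sum using (_⊎_; inj₁; inj₂)
open import Data.Empty using (⊥-elim)
open import Data.Unit using (tt)
open import Function using (_∘_)
open import Function.Bundles using (_⇔_; mk⇔)
open import Function.Definitions using (Injective)
open import Relation.Nullary using (¬_; yes; no; ¬?; contradiction)
open import Relation.Nullary.Decidable using (decidable-stable)
open import Relation.Unary using (Decidable)
open import Relation.Binary.PropositionalEquality
  using (_≡_; _≢_; refl; sym; trans; cong; subst; module ≡-Reasoning)

injective⇒⊈Vec : ∀ {s} {A : Set} (xs : Vec A s) {f : Fin (suc s) → A} →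
                 Injective _≡_ _≡_ f → ¬ (∀ j → f j ∈ xs)
injective⇒⊈Vec {s} xs {f} f-injective f∈xs =
  <⇒notInjective (n<1+n s) position-injective
  where
  position : Fin (suc s) → Fin s
  position j = index (f∈xs j)

  position-injective : Injective _≡_ _≡_ position
  position-injective {i} {j} eq = f-injective (begin
    f i                  ≡⟨ lookup-index (f∈xs i) ⟩
    lookup xs (position i) ≡⟨ cong (lookup xs) eq ⟩
    lookup xs (position j) ≡⟨ sym (lookup-index (f∈xs j)) ⟩
    f j                  ∎)
    where open ≡-Reasoning

MissesValue : ∀ {m k} → (Fin m → Fin k) → Set
MissesValue f = ∃ λ y → ∀ x → f x ≢ y

missesValue⇒¬injective : ∀ {k} (f : Fin k → Fin k) →
                         MissesValue f → ¬ Injective _≡_ _≡_ f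
missesValue⇒¬injective {suc k} f (y , f≢y) f-injective =
  <⇒notInjective (n<1+n k) squeezed-injective
  where
  squeezed : Fin (suc k) → Fin k
  squeezed x = punchOut (f≢y x ∘ sym)

  squeezed-injective : Injective _≡_ _≡_ squeezed
  squeezed-injective {x} {x′} eq =
    f-injective (punchOut-injective (f≢y x ∘ sym) (f≢y x′ ∘ sym) eq)

surjective⇒injective : ∀ {k} (f : Fin k → Fin k) →
                       (∀ y → ∃ λ x → f x ≡ y) → Injective _≡_ _≡_ f
surjective⇒injective {suc k} f surj {i} {j} fi≡fj with i ≟ j
... | yes i≡j = i≡j
... | no i≢j = ⊥-elim (<⇒notInjective (n<1+n k) section-injective)
  where
  -- j is a second preimage of f i, so every value has a preimage other than i.
  preimage : ∀ y → ∃ λ x → i ≢ x × f x ≡ y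
  preimage y with surj y
  ... | x , fx≡y with i ≟ x
  ...   | yes refl = j , i≢j , trans (sym fi≡fj) fx≡y
  ...   | no i≢x = x , i≢x , fx≡y

  section : Fin (suc k) → Fin k
  section y = punchOut (proj₁ (proj₂ (preimage y)))

  section-injective : Injective _≡_ _≡_ section
  section-injective {y} {y′} eq = begin
    y                       ≡⟨ sym (proj₂ (proj₂ (preimage y))) ⟩
    f (proj₁ (preimage y))  ≡⟨ cong f (punchOut-injective avoids-i avoids-i′ eq) ⟩
    f (proj₁ (preimage y′)) ≡⟨ proj₂ (proj₂ (preimage y′)) ⟩
    y′                      ∎
    where
    open ≡-Reasoning
    avoids-i  = proj₁ (proj₂ (preimage y))
    avoids-i′ = proj₁ (proj₂ (preimage y′))

injective⊎missesValue : ∀ {k} (f : Fin k → Fin k) →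
                        Injective _≡_ _≡_ f ⊎ MissesValue f
injective⊎missesValue f with any? (λ y → all? (λ x → ¬? (f x ≟ y)))
... | yes misses = inj₂ misses
... | no ¬misses = inj₁ (surjective⇒injective f preimage)
  where
  preimage : ∀ y → ∃ λ x → f x ≡ y
  preimage y with ¬∀⟶∃¬ _ (λ x → f x ≢ y) (λ x → ¬? (f x ≟ y)) (¬misses ∘ (y ,_))
  ... | x , ¬fx≢y = x , decidable-stable (f x ≟ y) ¬fx≢y

∃⊎∀ : ∀ {n} {P Q : Fin n → Set} → (∀ i → P i ⊎ Q i) → ∃ P ⊎ (∀ i → Q i)
∃⊎∀ {zero}  _   = inj₂ λ ()
∃⊎∀ {suc n} P⊎Q with P⊎Q zero | ∃⊎∀ (P⊎Q ∘ suc)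
... | inj₁ p | _            = inj₁ (zero , p)
... | inj₂ _ | inj₁ (i , p) = inj₁ (suc i , p)
... | inj₂ q | inj₂ qs      = inj₂ λ { zero → q ; (suc i) → qs i }

HasDistinct : ∀ {m} → (Fin m → Set) → ℕ → Set
HasDistinct {m} P k = ∃ λ (f : Fin k → Fin m) → Injective _≡_ _≡_ f × (∀ j → P (f j))

hasDistinct-suc : ∀ {m k} {P : Fin (suc m) → Set} →
                  HasDistinct (P ∘ suc) k → HasDistinct P k
hasDistinct-suc (f , f-injective , Pf) =
  suc ∘ f , f-injective ∘ suc-injective , Pf

hasDistinct-cons : ∀ {m k} {P : Fin (suc m) → Set} →
                   P zero → HasDistinct (P ∘ suc) k → HasDistinct P (suc k)
hasDistinct-cons {P = P} P0 (f , f-injective , Pf) = g , g-injective , Pg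
  where
  g : Fin (suc _) → Fin (suc _)
  g zero    = zero
  g (suc j) = suc (f j)

  g-injective : Injective _≡_ _≡_ g
  g-injective {zero}  {zero}  _  = refl
  g-injective {zero}  {suc _} ()
  g-injective {suc _} {zero}  ()
  g-injective {suc i} {suc j} eq = cong suc (f-injective (suc-injective eq))

  Pg : ∀ j → P (g j)
  Pg zero    = P0
  Pg (suc j) = Pf j

hasDistinct-1 : ∀ {m} {P : Fin m → Set} {c : Fin m} → P c → HasDistinct P 1
hasDistinct-1 {c = c} Pc = (λ _ → c) , (λ { {zero} {zero} _ → refl }) , (λ _ → Pc)

¬hasDistinct⇒listed : ∀ {m} {P : Fin m → Set} → Decidable P → ∀ s →
                      ¬ HasDistinct P (suc s) →
                      ∃ λ (l : List (Fin m)) → length l ≤ s × (∀ {c} → P c → c ∈ₗ l)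
¬hasDistinct⇒listed {zero} _ s _ = [] , z≤n , λ { {()} }
¬hasDistinct⇒listed {suc m} {P} P? s few with P? zero
... | no ¬P0 with ¬hasDistinct⇒listed (P? ∘ suc) s (few ∘ hasDistinct-suc {P = P})
...   | l , l≤s , listed =
  map suc l , subst (_≤ s) (sym (length-map suc l)) l≤s , covers
  where
  covers : ∀ {c} → P c → c ∈ₗ map suc l
  covers {zero}  P0 = contradiction P0 ¬P0
  covers {suc c} Pc = ∈-map⁺ suc (listed Pc)
¬hasDistinct⇒listed {suc m} {P} P? zero few | yes P0 =
  contradiction (hasDistinct-1 {P = P} P0) few
¬hasDistinct⇒listed {suc m} {P} P? (suc s) few | yes P0
  with ¬hasDistinct⇒listed (P? ∘ suc) s (few ∘ hasDistinct-cons {P = P} P0)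
... | l , l≤s , listed =
  zero ∷ map suc l , s≤s (subst (_≤ s) (sym (length-map suc l)) l≤s) , covers
  where
  covers : ∀ {c} → P c → c ∈ₗ zero ∷ map suc l
  covers {zero}  _  = ListAny.here refl
  covers {suc c} Pc = ListAny.there (∈-map⁺ suc (listed Pc))

∈-padRight : ∀ {A : Set} {m n} (m≤n : m ≤ n) (a : A) {x : A} {xs : Vec A m} →
             x ∈ xs → x ∈ padRight m≤n a xs
∈-padRight (s≤s m≤n) a (here x≡y)  = here x≡y
∈-padRight (s≤s m≤n) a (there x∈xs) = there (∈-padRight m≤n a x∈xs)

¬hasDistinct⇒covered : ∀ {m} {P : Fin m → Set} → Fin m → Decidable P → ∀ s →
                       ¬ HasDistinct P (suc s) →
                       ∃ λ (v : Vec (Fin m) s) → ∀ {c} → P c → c ∈ v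
¬hasDistinct⇒covered default P? s few with ¬hasDistinct⇒listed P? s few
... | l , l≤s , listed =
  padRight l≤s default (fromList l) , ∈-padRight l≤s default ∘ ∈-fromList⁺ ∘ listed

-- In the game, the columns of a that avoid x are the centre colours at which
-- no leaf guesses right when the leaves wear x.
Avoids : ∀ {N k v} → (Fin N → Fin k → Fin v) → (Fin N → Fin v) → Fin k → Set
Avoids a x c = ∀ r → a r c ≢ x r

avoids? : ∀ {N k v} (a : Fin N → Fin k → Fin v) (x : Fin N → Fin v) → Decidable (Avoids a x)
avoids? a x c = all? (λ r → ¬? (a r c ≟ x r))

isPHF⇒¬hasDistinctAvoiding : ∀ {N k v} {a : Fin N → Fin k → Fin v} → IsPHF N k v v a →
                             ∀ x → ¬ HasDistinct (Avoids a x) v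
isPHF⇒¬hasDistinctAvoiding {a = a} phf x (cols , cols-injective , avoid)
  with phf cols cols-injective
... | r , row-injective =
  missesValue⇒¬injective (λ j → a r (cols j)) (x r , λ j → avoid j r) row-injective

¬hasDistinctAvoiding⇒isPHF : ∀ {N k v} {a : Fin N → Fin k → Fin v} →
                             (∀ x → ¬ HasDistinct (Avoids a x) v) → IsPHF N k v v a
¬hasDistinctAvoiding⇒isPHF {a = a} few cols cols-injective
  with ∃⊎∀ (λ r → injective⊎missesValue (λ j → a r (cols j)))
... | inj₁ injectiveRow = injectiveRow
... | inj₂ misses =
  ⊥-elim (few (proj₁ ∘ misses) (cols , cols-injective , λ j r → proj₂ (misses r) j))

∈-head : ∀ {A : Set} {x : A} {v : Vec A 1} → x ∈ v → x ≡ head v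
∈-head {v = _ ∷ []} (here x≡y) = x≡y

module StarGame (s H n : ℕ) where

  Hats : Set
  Hats = Coloring (K1 n) (hSH s H n)
  StarStrategy : Set
  StarStrategy = Strategy (K1 n) (hSH s H n) (gS s n)

  hats : Fin H → (Fin n → Fin (suc s)) → Hats
  hats c x zero    = c
  hats c x (suc i) = x i

  leafTable : StarStrategy → Fin n → Fin H → Fin (suc s)
  leafTable f i c = head (f (suc i) (hats c (λ _ → zero)))

  winning⇒¬hasDistinctAvoiding : ((f , _) : Winning (K1 n) (hSH s H n) (gS s n)) →
                                 ∀ x → ¬ HasDistinct (Avoids (leafTable f) x) (suc s)
  winning⇒¬hasDistinctAvoiding (f , local , wins) x (cols , cols-injective , avoid) =
    injective⇒⊈Vec (f zero (hats (cols zero) x)) cols-injective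
                    (λ j → avoiding∈centreGuess (avoid j))
    where
    avoiding∈centreGuess : ∀ {c c′} → Avoids (leafTable f) x c → c ∈ f zero (hats c′ x)
    avoiding∈centreGuess {c} {c′} avoids with wins (hats c x)
    ... | zero , c∈guess =
      subst (c ∈_) (local zero _ _ λ { zero () ; (suc i) _ → refl }) c∈guess
    ... | suc i , xi∈guess =
      contradiction (sym (∈-head (subst (x i ∈_) sameLeafGuess xi∈guess))) (avoids i)
      where
      sameLeafGuess : f (suc i) (hats c x) ≡ f (suc i) (hats c (λ _ → zero))
      sameLeafGuess = local (suc i) _ _ λ { zero _ → refl ; (suc j) () }

  module _ (a : Fin n → Fin H → Fin (suc s)) (default : Fin H)
           (few : ∀ x → ¬ HasDistinct (Avoids a x) (suc s)) where

    coverAvoiding : (xs : Vec (Fin (suc s)) n) →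
                    ∃ λ (v : Vec (Fin H) s) → ∀ {c} → Avoids a (lookup xs) c → c ∈ v
    coverAvoiding xs = ¬hasDistinct⇒covered default (avoids? a (lookup xs)) s (few (lookup xs))

    -- The centre reads the leaf colours as a vector rather than a function,
    -- so that locality needs only tabulate-cong, not function extensionality.
    leafColours : Hats → Vec (Fin (suc s)) n
    leafColours c = tabulate (λ i → c (suc i))

    strategy : StarStrategy
    strategy zero    c = proj₁ (coverAvoiding (leafColours c))
    strategy (suc i) c = a i (c zero) ∷ []

    strategy-local : Local (K1 n) (hSH s H n) (gS s n) strategy
    strategy-local zero    c c′ agree =
      cong (proj₁ ∘ coverAvoiding) (tabulate-cong (λ i → agree (suc i) tt))
    strategy-local (suc i) c c′ agree = cong (λ y → a i y ∷ []) (agree zero tt)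

    strategy-wins : (c : Hats) → ∃ λ v → c v ∈ strategy v c
    strategy-wins c with any? (λ i → a i (c zero) ≟ c (suc i))
    ... | yes (i , hit) = suc i , here (sym hit)
    ... | no noHit = zero , proj₂ (coverAvoiding (leafColours c)) avoids
      where
      avoids : Avoids a (lookup (leafColours c)) (c zero)
      avoids i hit = noHit (i , trans hit (lookup∘tabulate (λ j → c (suc j)) i))

    ¬hasDistinctAvoiding⇒winning : Winning (K1 n) (hSH s H n) (gS s n)
    ¬hasDistinctAvoiding⇒winning = strategy , strategy-local , strategy-wins

corollary3p6 : (s H n : ℕ) → 0 < s → 0 < H → 0 < n →
    Winning (K1 n) (hSH s H n) (gS s n) ⇔ PHFExists n H (suc s) (suc s)
corollary3p6 s (suc H) n _ _ _ = mk⇔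
  (λ w → leafTable (proj₁ w) ,
         ¬hasDistinctAvoiding⇒isPHF {a = leafTable (proj₁ w)} (winning⇒¬hasDistinctAvoiding w))
  (λ (a , phf) → ¬hasDistinctAvoiding⇒winning a zero (isPHF⇒¬hasDistinctAvoiding {a = a} phf))
  where open StarGame s (suc H) n
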